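{- Let $r,q$ be positive integers, $k\ge1$, $p_1,\dots,p_k\ge1$, and let $s_i,\nu$ be integers and $a_{ij}>0$ integers. Suppose $B(n)=\lceil rn/q\rceil$ formally satisfies the recursion $R(n)=\sum_{i=1}^k R\big(n-s_i-\sum_{j=1}^{p_i}R(n-a_{ij})\big)+\nu$, and suppose $rp_i/q\le 1$ for all $i$. Then there exist a recursion $R'$ of the same form whose parameter vector is equivalent to that of $R$, and an integer $m$, such that $\lceil rn/q\rceil$ is the unique solution generated by $R'$ with initial conditions $R'(1)=\lceil r/q\rceil, R'(2)=\lceil 2r/q\rceil,\dots,R'(m)=\lceil mr/q\rceil$. If moreover $rp_i/q<1$ for all $i$, then the same conclusion holds for $R$ itself (taking $R'=R$).
   Context: $B$ formally satisfies the recursion if for every $n$, replacing every occurrence of $R$ by $B$ gives a true equality. A recursion with initial conditions $R(1),\dots,R(m)$ generates a sequence as its unique solution if for every $n>m$ all arguments at which $R$ must be evaluated to compute $R(n)$ (namely $n-a_{ij}$ and $n-s_i-\sum_j R(n-a_{ij})$) lie in $\{1,\dots,n-1\}$, so that $R(n)$ is determined recursively, and the resulting sequence is the given one. The parameter vector of $R$ is $\langle s_1;a_{11},\dots,a_{1p_1}:\cdots:s_k;a_{k1},\dots,a_{kp_k}|\nu\rangle$; two parameter vectors are equivalent if one is obtained from the other by finitely many moves of the form (i) replace $s_i$ by $s_i+dr$ and $a_{ij}$ by $a_{ij}+dq$ ($d\in\mathbb{Z}$), or (ii) replace $s_i$ by $s_i+cq$ and $\nu$ by $\nu+cr$ ($c\in\mathbb{Z}$).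 -}

module Defs where

open import Data.Nat as ℕ using (ℕ; zero; suc; NonZero; _≡ᵇ_)
open import Data.Integer using (ℤ; +_; _+_; _-_; _*_; -_; _/ℕ_; _≤_; _<_)
open import Data.Fin using (Fin; toℕ)
import Data.Fin as F
open import Data.Bool using (_∧_; if_then_else_)
open import Data.Product using (_×_)
open import Relation.Binary.PropositionalEquality using (_≡_)
open import Relation.Binary.Construct.Closure.ReflexiveTransitive using (Star)

sumFin : (n : ℕ) → (Fin n → ℤ) → ℤ
sumFin zero    f = + 0
sumFin (suc n) f = f F.zero + sumFin n (λ i → f (F.suc i))

ceilDiv : ℤ → (q : ℕ) → .{{NonZero q}} → ℤ
ceilDiv x q = - ((- x) /ℕ q)

B : (r q : ℕ) → .{{NonZero q}} → ℤ → ℤ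
B r q n = ceilDiv (+ r * n) q

-- A parameter vector ⟨ s₁; a₁₁ … a₁ₚ₁ : … : s_k; a_k1 … a_kp_k | ν ⟩
-- with fixed shape k, p₁ … p_k.
record Param (k : ℕ) (p : Fin k → ℕ) : Set where
  constructor ⟨_,_,_⟩
  field
    s : Fin k → ℤ
    a : (i : Fin k) → Fin (p i) → ℤ
    ν : ℤ
open Param public

arg : ∀ {k p} → Param k p → (ℤ → ℤ) → ℤ → Fin k → ℤ
arg {k} {p} P f n i = n - s P i - sumFin (p i) (λ j → f (n - a P i j))

rhs : ∀ {k p} → Param k p → (ℤ → ℤ) → ℤ → ℤ
rhs {k} P f n = sumFin k (λ i → f (arg P f n i)) + ν P

FormallySatisfies : ∀ {k p} → Param k p → (ℤ → ℤ) → Set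
FormallySatisfies P f = ∀ (n : ℤ) → f n ≡ rhs P f n

-- With initial conditions R(1) = f(1), …, R(m) = f(m), the recursion with
-- parameters P generates f as its unique solution: for every n > m all
-- arguments needed to compute R(n) lie in {1, …, n-1} and the recursion holds.
-- (By strong induction on n this says exactly that the recursively determined
-- sequence exists for all n ≥ 1 and coincides with f on n ≥ 1.)
Generates : ∀ {k p} → Param k p → ℕ → (ℤ → ℤ) → Set
Generates {k} {p} P m f =
  ∀ (n : ℤ) → + m < n →
    (∀ (i : Fin k) (j : Fin (p i)) →
        (+ 1 ≤ n - a P i j) × (n - a P i j ≤ n - + 1))
    × (∀ (i : Fin k) → (+ 1 ≤ arg P f n i) × (arg P f n i ≤ n - + 1))
    × (f n ≡ rhs P f n)

δ : ∀ {k} {p : Fin k → ℕ} (i₀ : Fin k) (j₀ : Fin (p i₀)) (i : Fin k) (j : Fin (p i)) → ℤ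
δ i₀ j₀ i j = if (toℕ i ≡ᵇ toℕ i₀) ∧ (toℕ j ≡ᵇ toℕ j₀) then + 1 else + 0

δ₁ : ∀ {k} (i₀ i : Fin k) → ℤ
δ₁ i₀ i = if toℕ i ≡ᵇ toℕ i₀ then + 1 else + 0

data Move {k} {p : Fin k → ℕ} (r q : ℕ) : Param k p → Param k p → Set where
  move-i  : ∀ {P P'} (i₀ : Fin k) (j₀ : Fin (p i₀)) (d : ℤ) →
            (∀ i → s P' i ≡ s P i + δ₁ i₀ i * (d * + r)) →
            (∀ i j → a P' i j ≡ a P i j + δ i₀ j₀ i j * (d * + q)) →
            ν P' ≡ ν P →
            Move r q P P'
  move-ii : ∀ {P P'} (i₀ : Fin k) (c : ℤ) →
            (∀ i → s P' i ≡ s P i + δ₁ i₀ i * (c * + q)) →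
            (∀ i j → a P' i j ≡ a P i j) →
            ν P' ≡ ν P + c * + r →
            Move r q P P'

Equivalent : ∀ {k p} (r q : ℕ) → Param k p → Param k p → Set
Equivalent r q = Star (Move r q)

module Submission where

-- Let B(n) = ⌈rn/q⌉ and, for the i-th summand of the recursion,
-- S_i(n) = Σ_j B(n - a_ij), so that its argument is n - s_i - S_i(n).  Since
-- q B(y) lies in [ry, ry + q), q S_i(n) lies between r(n - a_ij) and
-- p_i(rn + q).  Hence, using r ≥ 1, the argument is ≤ n - 1 for all large n,
-- and it is ≥ 1 for all large n as soon as q(1 + s_i + p_i) + r p_i n ≤ q n
-- holds eventually.  This is automatic when r p_i < q; when only r p_i ≤ q
-- it holds once 1 + s_i + p_i ≤ 0, which a move of type (ii) on every summand
-- arranges: replacing each s_i by s_i - C q and ν by ν - k C r keeps B a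
-- formal solution because B(x + t q) = B(x) + t r.
-- The file develops, in order: properties holding eventually, finite sums,
-- ceiling division, the passage from eventual range conditions to generation,
-- bounds on B and on the arguments of the recursion, and the uniform shift of
-- a parameter vector.  Theorem 4 combines these facts.

open import Defs
open import Data.Nat using (ℕ; NonZero) renaming (_≤_ to _≤ℕ_; _<_ to _<ℕ_; _*_ to _*ℕ_)
open import Data.Integer using (ℤ; +_; _<_)
open import Data.Fin using (Fin)
open import Data.Product using (Σ; _×_; ∃)

open import Data.Nat using (zero; suc; _⊔_; _<ᵇ_; _≡ᵇ_; >-nonZero⁻¹)
import Data.Nat.Properties as ℕ
open import Data.Integer
  using (-[1+_]; _≤_; _+_; _-_; _*_; -_; +≤+; -≤+; +<+; _/ℕ_; _%ℕ_; 0ℤ; 1ℤ; positive; nonNegative)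
  renaming (suc to sucℤ)
open import Data.Integer.Properties
open import Algebra.Properties.CommutativeSemigroup +-commutativeSemigroup
  using () renaming (interchange to +-interchange)
open import Data.Integer.DivMod using (a≡a%ℕn+[a/ℕn]*n; n%ℕd<d)
open import Data.Integer.Tactic.RingSolver using (solve-∀)
open import Data.Fin using (zero; suc; toℕ; fromℕ<)
open import Data.Fin.Properties using (toℕ<n; toℕ-fromℕ<)
open import Data.Bool using (true; if_then_else_)
open import Data.Product using (_,_; proj₁; proj₂)
open import Relation.Binary.PropositionalEquality
open import Relation.Binary.Construct.Closure.ReflexiveTransitive using (ε; _◅_; _◅◅_)

-- The recursion only has to be checked for n beyond the initial
-- conditions, so all bounds below are of this kind.
Eventually : (ℤ → Set) → Set
Eventually P = ∃ λ (m : ℕ) → ∀ n → + m ≤ n → P n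

eventually-≥ : ∀ b → Eventually (b ≤_)
eventually-≥ (+ m)    = m , λ _ m≤n → m≤n
eventually-≥ -[1+ m ] = 0 , λ _ 0≤n → ≤-trans -≤+ 0≤n

eventually-map : {P P′ : ℤ → Set} → (∀ {n} → P n → P′ n) → Eventually P → Eventually P′
eventually-map f (m , h) = m , λ n m≤n → f (h n m≤n)

eventually-× : {P P′ : ℤ → Set} → Eventually P → Eventually P′ → Eventually (λ n → P n × P′ n)
eventually-× (m , h) (m′ , h′) =
  m ⊔ m′ , λ n mm′≤n → h  n (≤-trans (+≤+ (ℕ.m≤m⊔n m m′)) mm′≤n)
                     , h′ n (≤-trans (+≤+ (ℕ.m≤n⊔m m m′)) mm′≤n)

eventually-∀ : ∀ k {P : Fin k → ℤ → Set} → (∀ i → Eventually (P i)) → Eventually (λ n → ∀ i → P i n)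
eventually-∀ zero    _  = 0 , λ _ _ ()
eventually-∀ (suc k) {P} ev =
  eventually-map both (eventually-× (ev zero) (eventually-∀ k (λ i → ev (suc i))))
  where
  both : ∀ {n} → P zero n × (∀ i → P (suc i) n) → ∀ i → P i n
  both (h₀ , hs) zero    = h₀
  both (h₀ , hs) (suc i) = hs i

finite-upper-bound : ∀ k (b : Fin k → ℤ) → ∃ λ (C : ℕ) → ∀ i → b i ≤ + C
finite-upper-bound k b with eventually-∀ k (λ i → eventually-≥ (b i))
... | m , h = m , h (+ m) ≤-refl

sum-mono : ∀ n {f g : Fin n → ℤ} → (∀ j → f j ≤ g j) → sumFin n f ≤ sumFin n g
sum-mono zero    f≤g = ≤-refl
sum-mono (suc n) f≤g = +-mono-≤ (f≤g zero) (sum-mono n (λ j → f≤g (suc j)))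

sum-nonneg : ∀ n (f : Fin n → ℤ) → (∀ j → 0ℤ ≤ f j) → 0ℤ ≤ sumFin n f
sum-nonneg zero    f 0≤f = ≤-refl
sum-nonneg (suc n) f 0≤f = +-mono-≤ (0≤f zero) (sum-nonneg n (λ j → f (suc j)) (λ j → 0≤f (suc j)))

term≤sum : ∀ n (f : Fin n → ℤ) → (∀ j → 0ℤ ≤ f j) → ∀ j → f j ≤ sumFin n f
term≤sum (suc n) f 0≤f zero =
  i≤i+j (f zero) _ {{nonNegative (sum-nonneg n (λ j → f (suc j)) (λ j → 0≤f (suc j)))}}
term≤sum (suc n) f 0≤f (suc j) = ≤-trans
  (term≤sum n (λ j → f (suc j)) (λ j → 0≤f (suc j)) j)
  (i≤j+i (sumFin n (λ j → f (suc j))) (f zero) {{nonNegative (0≤f zero)}})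

sum-cong : ∀ n {f g : Fin n → ℤ} → (∀ j → f j ≡ g j) → sumFin n f ≡ sumFin n g
sum-cong zero    f≡g = refl
sum-cong (suc n) f≡g = cong₂ _+_ (f≡g zero) (sum-cong n (λ j → f≡g (suc j)))

sum-scale : ∀ n c (f : Fin n → ℤ) → c * sumFin n f ≡ sumFin n (λ j → c * f j)
sum-scale zero    c f = *-zeroʳ c
sum-scale (suc n) c f =
  trans (*-distribˡ-+ c (f zero) _) (cong (λ x → c * f zero + x) (sum-scale n c (λ j → f (suc j))))

sum-const : ∀ n c → sumFin n (λ _ → c) ≡ + n * c
sum-const zero    c = sym (*-zeroˡ c)
sum-const (suc n) c = trans (cong (λ x → c + x) (sum-const n c)) (sym (suc-* (+ n) c))

sum-+ : ∀ n (f g : Fin n → ℤ) → sumFin n (λ j → f j + g j) ≡ sumFin n f + sumFin n g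
sum-+ zero    f g = refl
sum-+ (suc n) f g = trans
  (cong (λ x → f zero + g zero + x) (sum-+ n (λ j → f (suc j)) (λ j → g (suc j))))
  (+-interchange (f zero) (g zero) _ _)

sum-shift : ∀ n (f : Fin n → ℤ) c → sumFin n (λ j → f j + c) ≡ sumFin n f + + n * c
sum-shift n f c = trans (sum-+ n f (λ _ → c)) (cong (λ x → sumFin n f + x) (sum-const n c))

module Ceiling (q : ℕ) .{{_ : NonZero q}} where

  Q : ℤ
  Q = + q

  ceil-spec : ∀ y → ∃ λ ρ → ρ <ℕ q × Q * ceilDiv y q ≡ y + + ρ
  ceil-spec y = (- y) %ℕ q , n%ℕd<d (- y) q , (begin
      Q * - f            ≡⟨ rearrange Q f ρ ⟩
      - (ρ + f * Q) + ρ  ≡⟨ cong (λ x → - x + ρ) (sym division) ⟩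
      - - y + ρ          ≡⟨ cong (λ x → x + ρ) (neg-involutive y) ⟩
      y + ρ              ∎)
    where
    open ≡-Reasoning
    f ρ : ℤ
    f = (- y) /ℕ q
    ρ = + ((- y) %ℕ q)
    division : - y ≡ ρ + f * Q
    division = a≡a%ℕn+[a/ℕn]*n (- y) q
    rearrange : ∀ Q f ρ → Q * - f ≡ - (ρ + f * Q) + ρ
    rearrange = solve-∀

  ceil-below : ∀ y {c c′ ρ ρ′} → ρ <ℕ q → Q * c ≡ y + + ρ → Q * c′ ≡ y + + ρ′ → c ≤ c′
  ceil-below y {c} {c′} {ρ} {ρ′} ρ<q qc qc′ =
    subst (c ≤_) (pred-suc c′) (i<j⇒i≤pred[j] (*-cancelˡ-<-nonNeg Q qc<q[c′+1]))
    where
    open ≤-Reasoning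
    distrib : ∀ Q c → Q * c + Q ≡ Q * (1ℤ + c)
    distrib = solve-∀
    qc<q[c′+1] : Q * c < Q * sucℤ c′
    qc<q[c′+1] = begin-strict
      Q * c         ≡⟨ qc ⟩
      y + + ρ       <⟨ +-monoʳ-< y (+<+ ρ<q) ⟩
      y + Q         ≤⟨ +-monoˡ-≤ Q (i≤i+j y (+ ρ′)) ⟩
      y + + ρ′ + Q  ≡⟨ cong (λ x → x + Q) (sym qc′) ⟩
      Q * c′ + Q    ≡⟨ distrib Q c′ ⟩
      Q * (1ℤ + c′) ∎

  ceil-unique : ∀ y {c ρ} → ρ <ℕ q → Q * c ≡ y + + ρ → c ≡ ceilDiv y q
  ceil-unique y ρ<q qc with ceil-spec y
  ... | ρ′ , ρ′<q , qc′ = ≤-antisym (ceil-below y ρ<q qc qc′) (ceil-below y ρ′<q qc′ qc)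

  ceil-shift : ∀ y t → ceilDiv (y + t * Q) q ≡ ceilDiv y q + t
  ceil-shift y t with ceil-spec y
  ... | ρ , ρ<q , qc = sym (ceil-unique (y + t * Q) ρ<q (begin
      Q * (ceilDiv y q + t)  ≡⟨ *-distribˡ-+ Q (ceilDiv y q) t ⟩
      Q * ceilDiv y q + Q * t ≡⟨ cong (λ x → x + Q * t) qc ⟩
      y + + ρ + Q * t         ≡⟨ rearrange y (+ ρ) Q t ⟩
      y + t * Q + + ρ         ∎))
    where
    open ≡-Reasoning
    rearrange : ∀ y ρ Q t → y + ρ + Q * t ≡ y + t * Q + ρ
    rearrange = solve-∀

  ceil-lower : ∀ y → y ≤ Q * ceilDiv y q
  ceil-lower y with ceil-spec y
  ... | ρ , _ , qc = subst (y ≤_) (sym qc) (i≤i+j y (+ ρ))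

  ceil-upper : ∀ y → Q * ceilDiv y q ≤ y + Q
  ceil-upper y with ceil-spec y
  ... | ρ , ρ<q , qc = subst (_≤ y + Q) (sym qc) (+-monoʳ-≤ y (+≤+ (ℕ.<⇒≤ ρ<q)))

ArgsInRange : ∀ {k p} → Param k p → (ℤ → ℤ) → ℤ → Set
ArgsInRange {k} {p} P f n =
    (∀ (i : Fin k) (j : Fin (p i)) → (+ 1 ≤ n - a P i j) × (n - a P i j ≤ n - + 1))
  × (∀ (i : Fin k) → (+ 1 ≤ arg P f n i) × (arg P f n i ≤ n - + 1))

generates : ∀ {k p} (P : Param k p) (f : ℤ → ℤ) →
            FormallySatisfies P f → Eventually (ArgsInRange P f) → ∃ λ m → Generates P m f
generates P f sat (m , inRange) = m , λ n m<n →
  let (delays , args) = inRange n (<⇒≤ m<n) in delays , args , sat n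

delays-in-range : ∀ {k p} (P : Param k p) → (∀ i j → 0ℤ < a P i j) →
                  Eventually (λ n → ∀ i j → (+ 1 ≤ n - a P i j) × (n - a P i j ≤ n - + 1))
delays-in-range {k} {p} P 0<a =
  eventually-∀ k λ i → eventually-∀ (p i) λ j → eventually-map (in-range i j) (eventually-≥ (1ℤ + a P i j))
  where
  cancel : ∀ x y → x + y - y ≡ x
  cancel = solve-∀
  in-range : ∀ i j {n} → 1ℤ + a P i j ≤ n → (+ 1 ≤ n - a P i j) × (n - a P i j ≤ n - + 1)
  in-range i j {n} 1+a≤n =
      subst (_≤ n - a P i j) (cancel 1ℤ (a P i j)) (+-monoˡ-≤ (- a P i j) 1+a≤n)
    , +-monoʳ-≤ n (neg-mono-≤ (i<j⇒suc[i]≤j (0<a i j)))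

module Bounds (r q : ℕ) .{{_ : NonZero q}} where

  open Ceiling q public

  R : ℤ
  R = + r

  0<Q : 0ℤ < Q
  0<Q = +<+ (>-nonZero⁻¹ q)

  1≤Q : 1ℤ ≤ Q
  1≤Q = i<j⇒suc[i]≤j 0<Q

  pR≡rp : ∀ p → + p * R ≡ + (r *ℕ p)
  pR≡rp p = trans (sym (pos-* p r)) (cong +_ (ℕ.*-comm p r))

  B-lower : ∀ y → R * y ≤ Q * B r q y
  B-lower y = ceil-lower (R * y)

  B-upper : ∀ y → Q * B r q y ≤ R * y + Q
  B-upper y = ceil-upper (R * y)

  -- B(x + t q) = B(x) + t r; this is why moves of type (ii) preserve formal solutions.
  B-shift : ∀ x t → B r q (x + t * Q) ≡ B r q x + t * R
  B-shift x t = trans (cong (λ y → ceilDiv y q) (distrib R x t Q)) (ceil-shift (R * x) (t * R))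
    where
    distrib : ∀ R x t Q → R * (x + t * Q) ≡ R * x + t * R * Q
    distrib = solve-∀

  B-nonneg : ∀ y → 0ℤ ≤ y → 0ℤ ≤ B r q y
  B-nonneg y 0≤y = *-cancelˡ-≤-pos 0ℤ (B r q y) Q {{positive 0<Q}} (begin
      Q * 0ℤ     ≡⟨ *-zeroʳ Q ⟩
      0ℤ         ≡⟨ *-zeroʳ R ⟨
      R * 0ℤ     ≤⟨ *-monoˡ-≤-nonNeg R 0≤y ⟩
      R * y      ≤⟨ B-lower y ⟩
      Q * B r q y ∎)
    where open ≤-Reasoning

  inner : (p : ℕ) → (Fin p → ℤ) → ℤ → ℤ
  inner p a n = sumFin p (λ j → B r q (n - a j))

  inner-upper : ∀ p a n → (∀ j → 0ℤ ≤ a j) → Q * inner p a n ≤ + p * (R * n + Q)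
  inner-upper p a n 0≤a = begin
      Q * inner p a n                   ≡⟨ sum-scale p Q (λ j → B r q (n - a j)) ⟩
      sumFin p (λ j → Q * B r q (n - a j)) ≤⟨ sum-mono p term ⟩
      sumFin p (λ _ → R * n + Q)         ≡⟨ sum-const p (R * n + Q) ⟩
      + p * (R * n + Q)                  ∎
    where
    open ≤-Reasoning
    term : ∀ j → Q * B r q (n - a j) ≤ R * n + Q
    term j = ≤-trans (B-upper (n - a j))
      (+-monoˡ-≤ Q (*-monoˡ-≤-nonNeg R (i-j≤i n (a j) {{nonNegative (0≤a j)}})))

  inner-lower : ∀ p a n → (∀ j → a j ≤ n) → ∀ j₀ → R * (n - a j₀) ≤ Q * inner p a n
  inner-lower p a n a≤n j₀ = ≤-trans (B-lower (n - a j₀)) (*-monoˡ-≤-nonNeg Q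
    (term≤sum p (λ j → B r q (n - a j)) (λ j → B-nonneg (n - a j) (i≤j⇒0≤j-i (a≤n j))) j₀))

  arg-lower : ∀ p a s n → (∀ j → 0ℤ ≤ a j) →
              Q * (1ℤ + s + + p) + + p * R * n ≤ Q * n → 1ℤ ≤ n - s - inner p a n
  arg-lower p a s n 0≤a h = *-cancelˡ-≤-pos 1ℤ (n - s - S) Q {{positive 0<Q}} (begin
      Q * 1ℤ                                                ≡⟨ split Q s (+ p) R n ⟩
      Q * (1ℤ + s + + p) + + p * R * n - (+ p * R * n + Q * (s + + p)) ≤⟨ +-monoˡ-≤ _ h ⟩
      Q * n - (+ p * R * n + Q * (s + + p))                 ≡⟨ regroup Q s (+ p) R n ⟩
      Q * n - Q * s - + p * (R * n + Q)                     ≤⟨ +-monoʳ-≤ (Q * n - Q * s) (neg-mono-≤ (inner-upper p a n 0≤a)) ⟩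
      Q * n - Q * s - Q * S                                 ≡⟨ factor Q n s S ⟩
      Q * (n - s - S)                                       ∎)
    where
    open ≤-Reasoning
    S : ℤ
    S = inner p a n
    split : ∀ Q s P R n → Q * 1ℤ ≡ Q * (1ℤ + s + P) + P * R * n - (P * R * n + Q * (s + P))
    split = solve-∀
    regroup : ∀ Q s P R n → Q * n - (P * R * n + Q * (s + P)) ≡ Q * n - Q * s - P * (R * n + Q)
    regroup = solve-∀
    factor : ∀ Q n s S → Q * n - Q * s - Q * S ≡ Q * (n - s - S)
    factor = solve-∀

  arg-upper : 1 ≤ℕ r → ∀ p a s n → (∀ j → a j ≤ n) → ∀ j₀ →
              Q - Q * s + a j₀ ≤ n → n - s - inner p a n ≤ n - 1ℤ
  arg-upper r≥1 p a s n a≤n j₀ h = begin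
      n - s - S    ≡⟨ assoc n s S ⟩
      n - (s + S)  ≤⟨ +-monoʳ-≤ n (neg-mono-≤ 1≤s+S) ⟩
      n - 1ℤ       ∎
    where
    open ≤-Reasoning
    S x : ℤ
    S = inner p a n
    x = n - a j₀
    assoc : ∀ n s S → n - s - S ≡ n - (s + S)
    assoc = solve-∀
    split : ∀ Q s a → Q * 1ℤ ≡ Q - Q * s + a - a + Q * s
    split = solve-∀
    factor : ∀ Q s S → Q * S + Q * s ≡ Q * (s + S)
    factor = solve-∀
    x≤Rx : x ≤ R * x
    x≤Rx = subst (_≤ R * x) (*-identityˡ x)
      (*-monoʳ-≤-nonNeg x {{nonNegative (i≤j⇒0≤j-i (a≤n j₀))}} (+≤+ r≥1))
    1≤s+S : 1ℤ ≤ s + S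
    1≤s+S = *-cancelˡ-≤-pos 1ℤ (s + S) Q {{positive 0<Q}} (begin
      Q * 1ℤ                      ≡⟨ split Q s (a j₀) ⟩
      Q - Q * s + a j₀ - a j₀ + Q * s ≤⟨ +-monoˡ-≤ (Q * s) (+-monoˡ-≤ (- a j₀) h) ⟩
      x + Q * s                   ≤⟨ +-monoˡ-≤ (Q * s) x≤Rx ⟩
      R * x + Q * s               ≤⟨ +-monoˡ-≤ (Q * s) (inner-lower p a n a≤n j₀) ⟩
      Q * S + Q * s               ≡⟨ factor Q s S ⟩
      Q * (s + S)                 ∎)

  arg-lower-strict : ∀ p a s → (∀ j → 0ℤ ≤ a j) → r *ℕ p <ℕ q →
                     Eventually (λ n → 1ℤ ≤ n - s - inner p a n)
  arg-lower-strict p a s 0≤a rp<q =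
    eventually-map bound (eventually-× (eventually-≥ 0ℤ) (eventually-≥ (Q * (1ℤ + s + + p))))
    where
    open ≤-Reasoning
    1+pR≤Q : 1ℤ + + p * R ≤ Q
    1+pR≤Q = subst (λ x → 1ℤ + x ≤ Q) (sym (pR≡rp p)) (+≤+ rp<q)
    bound : ∀ {n} → 0ℤ ≤ n × Q * (1ℤ + s + + p) ≤ n → 1ℤ ≤ n - s - inner p a n
    bound {n} (0≤n , h) = arg-lower p a s n 0≤a (begin
      Q * (1ℤ + s + + p) + + p * R * n ≤⟨ +-monoˡ-≤ (+ p * R * n) h ⟩
      n + + p * R * n                  ≡⟨ suc-* (+ p * R) n ⟨
      (1ℤ + + p * R) * n               ≤⟨ *-monoʳ-≤-nonNeg n {{nonNegative 0≤n}} 1+pR≤Q ⟩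
      Q * n                            ∎)

  arg-lower-normalised : ∀ p a s → (∀ j → 0ℤ ≤ a j) → r *ℕ p ≤ℕ q → 1ℤ + s + + p ≤ 0ℤ →
                         Eventually (λ n → 1ℤ ≤ n - s - inner p a n)
  arg-lower-normalised p a s 0≤a rp≤q normalised = eventually-map bound (eventually-≥ 0ℤ)
    where
    open ≤-Reasoning
    bound : ∀ {n} → 0ℤ ≤ n → 1ℤ ≤ n - s - inner p a n
    bound {n} 0≤n = arg-lower p a s n 0≤a (begin
      Q * (1ℤ + s + + p) + + p * R * n ≤⟨ +-monoˡ-≤ (+ p * R * n) (*-monoˡ-≤-nonNeg Q normalised) ⟩
      Q * 0ℤ + + p * R * n             ≡⟨ cong (λ x → x + + p * R * n) (*-zeroʳ Q) ⟩
      0ℤ + + p * R * n                 ≡⟨ +-identityˡ (+ p * R * n) ⟩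
      + p * R * n                      ≤⟨ *-monoʳ-≤-nonNeg n {{nonNegative 0≤n}} pR≤Q ⟩
      Q * n                            ∎)
      where
      pR≤Q : + p * R ≤ Q
      pR≤Q = subst (_≤ Q) (sym (pR≡rp p)) (+≤+ rp≤q)

  arg-upper-eventually : 1 ≤ℕ r → ∀ p a s → 1 ≤ℕ p → Eventually (λ n → n - s - inner p a n ≤ n - 1ℤ)
  arg-upper-eventually r≥1 p a s p≥1 = eventually-map bound
    (eventually-× (eventually-∀ p (λ j → eventually-≥ (a j))) (eventually-≥ (Q - Q * s + a j₀)))
    where
    j₀ : Fin p
    j₀ = fromℕ< p≥1
    bound : ∀ {n} → (∀ j → a j ≤ n) × (Q - Q * s + a j₀ ≤ n) → n - s - inner p a n ≤ n - 1ℤ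
    bound {n} (a≤n , h) = arg-upper r≥1 p a s n a≤n j₀ h

  args-in-range : 1 ≤ℕ r → ∀ {k p} (P : Param k p) → (∀ i → 1 ≤ℕ p i) → (∀ i j → 0ℤ < a P i j) →
                  (∀ i → Eventually (λ n → 1ℤ ≤ arg P (B r q) n i)) → Eventually (ArgsInRange P (B r q))
  args-in-range r≥1 {k} {p} P p≥1 0<a lower = eventually-× (delays-in-range P 0<a)
    (eventually-∀ k λ i → eventually-× (lower i) (arg-upper-eventually r≥1 (p i) (a P i) (s P i) (p≥1 i)))

  shift-normalises : ∀ x (C : ℕ) → x ≤ + C → x + - + C * Q ≤ 0ℤ
  shift-normalises x C x≤C = begin
      x + - + C * Q   ≤⟨ +-monoˡ-≤ (- + C * Q) x≤C ⟩
      + C + - + C * Q ≡⟨ negate (+ C) Q ⟩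
      + C - + C * Q   ≤⟨ +-monoʳ-≤ (+ C) (neg-mono-≤ (*-monoˡ-≤-nonNeg (+ C) 1≤Q)) ⟩
      + C - + C * 1ℤ  ≡⟨ cancel (+ C) ⟩
      0ℤ              ∎
    where
    open ≤-Reasoning
    negate : ∀ C Q → C + - C * Q ≡ C - C * Q
    negate = solve-∀
    cancel : ∀ C → C - C * 1ℤ ≡ 0ℤ
    cancel = solve-∀

indicator-step : ∀ x t (u X : ℤ) →
  (if x <ᵇ suc t then u + X else u) ≡ (if x <ᵇ t then u + X else u) + (if x ≡ᵇ t then + 1 else + 0) * X
indicator-step zero    zero    u X = cong (λ y → u + y) (sym (*-identityˡ X))
indicator-step zero    (suc t) u X = sym (trans (cong (λ y → u + X + y) (*-zeroˡ X)) (+-identityʳ (u + X)))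
indicator-step (suc x) zero    u X = sym (trans (cong (λ y → u + y) (*-zeroˡ X)) (+-identityʳ u))
indicator-step (suc x) (suc t) u X = indicator-step x t u X

pointwise-move : ∀ {k p} (r q : ℕ) {P P′ : Param k p} → Fin k →
                 (∀ i → s P′ i ≡ s P i) → (∀ i j → a P′ i j ≡ a P i j) → ν P′ ≡ ν P → Move r q P P′
pointwise-move r q {P} i₀ s≡ a≡ ν≡ = move-ii i₀ 0ℤ
  (λ i → trans (s≡ i) (sym (trans (cong (λ y → s P i + y) (*-zeroʳ (δ₁ i₀ i))) (+-identityʳ (s P i)))))
  a≡ (trans ν≡ (sym (+-identityʳ (ν P))))

-- Shifting every s_i by c q and ν by k c r, obtained as k moves of type (ii)
-- applied to the summands one after another.
module UniformShift (r q : ℕ) {k : ℕ} {p : Fin k → ℕ} (c : ℤ) (P : Param k p) where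

  shifted : Param k p
  shifted = ⟨ (λ i → s P i + c * + q) , a P , ν P + + k * (c * + r) ⟩

  partial-ν : ℕ → ℤ
  partial-ν zero    = ν P
  partial-ν (suc t) = partial-ν t + c * + r

  partial : ℕ → Param k p
  partial t = ⟨ (λ i → if toℕ i <ᵇ t then s P i + c * + q else s P i) , a P , partial-ν t ⟩

  partial-move : ∀ t (t<k : t <ℕ k) → Move r q (partial t) (partial (suc t))
  partial-move t t<k = move-ii (fromℕ< t<k) c
    (λ i → subst (λ t′ → s (partial (suc t)) i ≡ s (partial t) i + (if toℕ i ≡ᵇ t′ then + 1 else + 0) * (c * + q))
                 (sym (toℕ-fromℕ< t<k)) (indicator-step (toℕ i) t (s P i) (c * + q)))
    (λ i j → refl) refl

  partial-chain : ∀ t → t ≤ℕ k → Equivalent r q P (partial t)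
  partial-chain zero    _   = ε
  partial-chain (suc t) t<k = partial-chain t (ℕ.<⇒≤ t<k) ◅◅ (partial-move t t<k ◅ ε)

  partial-complete : ∀ i → s (partial k) i ≡ s P i + c * + q
  partial-complete i with toℕ i <ᵇ k | ℕ.<⇒<ᵇ (toℕ<n i)
  ... | true | _ = refl

  partial-ν-closed : ∀ t → partial-ν t ≡ ν P + + t * (c * + r)
  partial-ν-closed zero    = sym (trans (cong (λ y → ν P + y) (*-zeroˡ (c * + r))) (+-identityʳ (ν P)))
  partial-ν-closed (suc t) = begin
      partial-ν t + Y      ≡⟨ cong (λ y → y + Y) (partial-ν-closed t) ⟩
      ν P + + t * Y + Y    ≡⟨ +-assoc (ν P) (+ t * Y) Y ⟩
      ν P + (+ t * Y + Y)  ≡⟨ cong (λ y → ν P + y) (+-comm (+ t * Y) Y) ⟩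
      ν P + (Y + + t * Y)  ≡⟨ cong (λ y → ν P + y) (suc-* (+ t) Y) ⟨
      ν P + + suc t * Y    ∎
    where
    open ≡-Reasoning
    Y : ℤ
    Y = c * + r

  shifted-equivalent : 1 ≤ℕ k → Equivalent r q P shifted
  shifted-equivalent k≥1 = partial-chain k ℕ.≤-refl ◅◅
    (pointwise-move r q (fromℕ< k≥1) (λ i → sym (partial-complete i)) (λ _ _ → refl) (sym (partial-ν-closed k)) ◅ ε)

  -- A formal solution f with f(x + t q) = f(x) + t r stays one after the shift:
  -- each argument moves by -c q, each term by -c r, and ν absorbs the difference.
  shifted-satisfies : {f : ℤ → ℤ} → (∀ x t → f (x + t * + q) ≡ f x + t * + r) →
                      FormallySatisfies P f → FormallySatisfies shifted f
  shifted-satisfies {f} periodic sat n = begin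
      f n                                              ≡⟨ sat n ⟩
      Σf + ν P                                         ≡⟨ balance Σf (+ k) c (+ r) (ν P) ⟩
      Σf + + k * (- c * + r) + ν shifted               ≡⟨ cong (λ x → x + ν shifted) (sum-shift k (λ i → f (arg P f n i)) (- c * + r)) ⟨
      sumFin k (λ i → f (arg P f n i) + - c * + r) + ν shifted ≡⟨ cong (λ x → x + ν shifted) (sum-cong k term) ⟨
      sumFin k (λ i → f (arg shifted f n i)) + ν shifted ∎
    where
    open ≡-Reasoning
    Σf : ℤ
    Σf = sumFin k (λ i → f (arg P f n i))
    balance : ∀ X K c R V → X + V ≡ X + K * (- c * R) + (V + K * (c * R))
    balance = solve-∀
    move-arg : ∀ n s S c Q → n - (s + c * Q) - S ≡ n - s - S + - c * Q
    move-arg = solve-∀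
    term : ∀ i → f (arg shifted f n i) ≡ f (arg P f n i) + - c * + r
    term i = trans (cong f (move-arg n (s P i) (sumFin (p i) (λ j → f (n - a P i j))) c (+ q)))
                   (periodic (arg P f n i) (- c))

-- Theorem 4.  With C ≥ 1 + s_i + p_i for all i, the vector P′ obtained by
-- shifting every s_i by -C q is equivalent to P, keeps B as a formal solution,
-- and satisfies 1 + s′_i + p_i ≤ 0; so B is generated by P′ when r p_i ≤ q,
-- and already by P when r p_i < q.
theorem4 : (r q : ℕ) → .{{_ : NonZero q}} → 1 ≤ℕ r →
    (k : ℕ) → 1 ≤ℕ k → (p : Fin k → ℕ) → (∀ i → 1 ≤ℕ p i) →
    (P : Param k p) → (∀ i j → + 0 < a P i j) →
    FormallySatisfies P (B r q) →
    (∀ i → r *ℕ p i ≤ℕ q) →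
    (Σ (Param k p) λ P' → Equivalent r q P P' × (∀ i j → + 0 < a P' i j)
        × ∃ λ (m : ℕ) → Generates P' m (B r q))
    × ((∀ i → r *ℕ p i <ℕ q) → ∃ λ (m : ℕ) → Generates P m (B r q))
theorem4 r q r≥1 k k≥1 p p≥1 P 0<a sat rp≤q =
    (shifted , shifted-equivalent k≥1 , 0<a
    , generates shifted (B r q) (shifted-satisfies B-shift sat) (args-in-range r≥1 shifted p≥1 0<a lower′))
  , λ rp<q → generates P (B r q) sat (args-in-range r≥1 P p≥1 0<a (lower rp<q))
  where
  open Bounds r q
  C : ℕ
  C = proj₁ (finite-upper-bound k (λ i → 1ℤ + s P i + + p i))
  C-bound : ∀ i → 1ℤ + s P i + + p i ≤ + C
  C-bound = proj₂ (finite-upper-bound k (λ i → 1ℤ + s P i + + p i))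
  open UniformShift r q (- + C) P
  0≤a : ∀ i j → 0ℤ ≤ a P i j
  0≤a i j = <⇒≤ (0<a i j)
  normalised : ∀ i → 1ℤ + s shifted i + + p i ≤ 0ℤ
  normalised i = subst (_≤ 0ℤ) (regroup (s P i) (+ p i) (- + C * Q))
    (shift-normalises (1ℤ + s P i + + p i) C (C-bound i))
    where
    regroup : ∀ s p x → 1ℤ + s + p + x ≡ 1ℤ + (s + x) + p
    regroup = solve-∀
  lower : (∀ i → r *ℕ p i <ℕ q) → ∀ i → Eventually (λ n → 1ℤ ≤ arg P (B r q) n i)
  lower rp<q i = arg-lower-strict (p i) (a P i) (s P i) (0≤a i) (rp<q i)
  lower′ : ∀ i → Eventually (λ n → 1ℤ ≤ arg shifted (B r q) n i)
  lower′ i = arg-lower-normalised (p i) (a P i) (s shifted i) (0≤a i) (rp≤q i) (normalised i)
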